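{- Let $m\geq 0$ and $\mathrm{MULT}_m=\{(a,b,c)\in\mathbb{Z}^3: a,b\in\{0,\dots,\varrho^m-1\}\text{ and }ab=c\}$. Every deterministic word automaton representing $\mathrm{MULT}_m$ has at least $\varrho^m$ states.
   Context: Encoding: fix an integer base $\varrho\geq 2$ and $\Sigma=\{0,\dots,\varrho-1\}$. For $b_{n-1}\dots b_0\in\Sigma^*$ let $\langle b_{n-1}\dots b_0\rangle_{\mathbb N}=\sum_{i<n}\varrho^i b_i$; for $b_nb_{n-1}\dots b_0\in\Sigma^+$ let $\langle b_n\dots b_0\rangle_{\mathbb Z}=\langle b_{n-1}\dots b_0\rangle_{\mathbb N}$ if $b_n=0$ and $\langle b_{n-1}\dots b_0\rangle_{\mathbb N}-\varrho^n$ if $b_n\neq 0$. A word over $\Sigma^3$ is read componentwise (track $i$ encodes the $i$th integer), giving $\langle w\rangle_{\mathbb Z}\in\mathbb{Z}^3$ for $w\in(\Sigma^3)^+$. A deterministic word automaton $\mathcal A$ over $\Sigma^3$ represents $U\subseteq\mathbb{Z}^3$ if $L(\mathcal A)=\{w\in(\Sigma^3)^+:\langle w\rangle_{\mathbb Z}\in U\}$. -}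

module Defs where

open import Data.Nat using (ℕ; zero; suc; _^_)
import Data.Nat as ℕ
open import Data.Integer using (ℤ; +_; _-_; _*_; _≤_; _<_)
open import Data.Fin using (Fin; toℕ)
open import Data.List using (List; []; _∷_; length; map; foldl)
open import Data.List.NonEmpty using (List⁺; _∷_)
import Data.List.NonEmpty as L⁺
open import Data.Product using (_×_; _,_; proj₁; proj₂)
open import Data.Bool using (Bool; true)
open import Relation.Binary.PropositionalEquality using (_≡_)
open import Function.Bundles using (_⇔_)

Digit : ℕ → Set
Digit ϱ = Fin ϱ

Letter : ℕ → Set
Letter ϱ = Digit ϱ × Digit ϱ × Digit ϱ

-- Words are written most-significant digit first: the list b_{n-1} ∷ … ∷ b_0 ∷ [].
-- ⟨b_{n-1} … b_0⟩_ℕ = Σ_{i<n} ϱ^i b_i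
valℕ : (ϱ : ℕ) → List (Digit ϱ) → ℕ
valℕ ϱ [] = 0
valℕ ϱ (d ∷ ds) = toℕ d ℕ.* (ϱ ^ length ds) ℕ.+ valℕ ϱ ds

-- ⟨b_n b_{n-1} … b_0⟩_ℤ (two's/ϱ's complement with sign digit b_n)
valℤ : (ϱ : ℕ) → List⁺ (Digit ϱ) → ℤ
valℤ ϱ (Fin.zero ∷ ds) = + valℕ ϱ ds
valℤ ϱ (Fin.suc _ ∷ ds) = + valℕ ϱ ds - + (ϱ ^ length ds)

decode : (ϱ : ℕ) → List⁺ (Letter ϱ) → ℤ × ℤ × ℤ
decode ϱ w =
  valℤ ϱ (L⁺.map proj₁ w) ,
  valℤ ϱ (L⁺.map (λ l → proj₁ (proj₂ l)) w) ,
  valℤ ϱ (L⁺.map (λ l → proj₂ (proj₂ l)) w)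

record DFA (ϱ k : ℕ) : Set where
  field
    initial   : Fin k
    δ         : Fin k → Letter ϱ → Fin k
    accepting : Fin k → Bool

open DFA public

run : ∀ {ϱ k} → DFA ϱ k → Fin k → List (Letter ϱ) → Fin k
run A q w = foldl (δ A) q w

Accepts : ∀ {ϱ k} → DFA ϱ k → List⁺ (Letter ϱ) → Set
Accepts A w = accepting A (run A (initial A) (L⁺.toList w)) ≡ true

Represents : ∀ {ϱ k} → DFA ϱ k → (ℤ × ℤ × ℤ → Set) → Set
Represents {ϱ} A U = ∀ (w : List⁺ (Letter ϱ)) → Accepts A w ⇔ U (decode ϱ w)

MULT : (ϱ m : ℕ) → ℤ × ℤ × ℤ → Set
MULT ϱ m (a , b , c) =
  (+ 0 ≤ a) × (a < + (ϱ ^ m)) × (+ 0 ≤ b) × (b < + (ϱ ^ m)) × (a * b ≡ c)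

{-# OPTIONS --safe #-}
-- Myhill–Nerode. Read the sign digit 0 followed by m letters whose a- and b-tracks are 0 and
-- whose c-track spells some x < ϱᵐ. For x < x′ take a = ϱᵐ − 1 and b = x + 1: then
-- ab = x·ϱᵐ + y with y = ϱᵐ − 1 − x < ϱᵐ, so appending the digits of a, b, y yields a word
-- accepted after x but rejected after x′ (as ab ≠ x′·ϱᵐ + y). Hence the ϱᵐ prefixes reach
-- pairwise distinct states.
module Submission where

open import Defs
open import Data.Nat using (ℕ; zero; suc; _+_; _*_; _^_; _≤_; _<_; z≤n; s≤s; NonZero)
open import Data.Nat.Properties
open import Data.Nat.Tactic.RingSolver using (solve-∀)
open import Data.Fin as F using (Fin; toℕ)
open import Data.Fin.Properties as F using (toℕ-fromℕ<; toℕ<n)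
open import Data.Vec as V using (Vec; []; _∷_; _++_; toList)
open import Data.Vec.Properties
  using (length-toList; toList-++; toList-map; map-∘; map-proj₁-zip; map-proj₂-zip; zipWith-++)
open import Data.List as L using (List)
open import Data.List.Properties using (foldl-++)
open import Data.List.NonEmpty as L⁺ using (List⁺; _∷_; _⁺++_)
open import Data.Product using (_×_; _,_; proj₁; proj₂; ∃; ∃₂)
open import Data.Integer using (+_; +≤+; +<+)
open import Data.Integer.Properties using (pos-*; +-injective)
open import Data.Bool using (true)
open import Function using (_∘_)
open import Function.Bundles using (_⇔_; mk⇔; Equivalence)
import Function.Properties.Equivalence as ⇔
open import Relation.Binary.Definitions using (tri<; tri≈; tri>)
open import Relation.Binary.PropositionalEquality
open import Relation.Nullary using (¬_; contradiction)

⟦_⟧ : ∀ {ϱ n} → Vec (Digit ϱ) n → ℕ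
⟦ ds ⟧ = valℕ _ (toList ds)

⟦∷⟧ : ∀ {ϱ n} (d : Digit ϱ) (ds : Vec (Digit ϱ) n) → ⟦ d ∷ ds ⟧ ≡ toℕ d * ϱ ^ n + ⟦ ds ⟧
⟦∷⟧ {ϱ} d ds = cong (λ l → toℕ d * ϱ ^ l + ⟦ ds ⟧) (length-toList ds)

⟦++⟧ : ∀ {ϱ m n} (xs : Vec (Digit ϱ) m) (ys : Vec (Digit ϱ) n) →
       ⟦ xs ++ ys ⟧ ≡ ⟦ xs ⟧ * ϱ ^ n + ⟦ ys ⟧
⟦++⟧ [] ys = refl
⟦++⟧ {ϱ} {suc m} {n} (d ∷ xs) ys = begin
  ⟦ d ∷ (xs ++ ys) ⟧                                 ≡⟨ ⟦∷⟧ d (xs ++ ys) ⟩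
  toℕ d * ϱ ^ (m + n) + ⟦ xs ++ ys ⟧                 ≡⟨ cong₂ (λ p q → toℕ d * p + q)
                                                         (^-distribˡ-+-* ϱ m n) (⟦++⟧ xs ys) ⟩
  toℕ d * (ϱ ^ m * ϱ ^ n) + (⟦ xs ⟧ * ϱ ^ n + ⟦ ys ⟧) ≡⟨ regroup (toℕ d) (ϱ ^ m) (ϱ ^ n) ⟦ xs ⟧ ⟦ ys ⟧ ⟩
  (toℕ d * ϱ ^ m + ⟦ xs ⟧) * ϱ ^ n + ⟦ ys ⟧         ≡⟨ cong (λ v → v * ϱ ^ n + ⟦ ys ⟧) (⟦∷⟧ d xs) ⟨
  ⟦ d ∷ xs ⟧ * ϱ ^ n + ⟦ ys ⟧                       ∎
  where
  open ≡-Reasoning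
  regroup : ∀ a p q u v → a * (p * q) + (u * q + v) ≡ (a * p + u) * q + v
  regroup = solve-∀

⟦replicate0++⟧ : ∀ {r m n} (ds : Vec (Digit (suc r)) n) → ⟦ V.replicate m F.zero ++ ds ⟧ ≡ ⟦ ds ⟧
⟦replicate0++⟧ {m = zero}  ds = refl
⟦replicate0++⟧ {m = suc m} ds = ⟦replicate0++⟧ {m = m} ds

digits : ∀ ϱ m → Fin (ϱ ^ m) → Vec (Digit ϱ) m
digits ϱ zero    _ = []
digits ϱ (suc m) x = proj₁ (F.remQuot {ϱ} (ϱ ^ m) x) ∷ digits ϱ m (proj₂ (F.remQuot {ϱ} (ϱ ^ m) x))

⟦digits⟧ : ∀ ϱ m (x : Fin (ϱ ^ m)) → ⟦ digits ϱ m x ⟧ ≡ toℕ x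
⟦digits⟧ ϱ zero    F.zero = refl
⟦digits⟧ ϱ (suc m) x = begin
  ⟦ d ∷ digits ϱ m x′ ⟧              ≡⟨ ⟦∷⟧ d (digits ϱ m x′) ⟩
  toℕ d * ϱ ^ m + ⟦ digits ϱ m x′ ⟧  ≡⟨ cong₂ _+_ (*-comm (toℕ d) (ϱ ^ m)) (⟦digits⟧ ϱ m x′) ⟩
  ϱ ^ m * toℕ d + toℕ x′             ≡⟨ F.toℕ-combine d x′ ⟨
  toℕ (F.combine d x′)               ≡⟨ cong toℕ (F.combine-remQuot {ϱ} (ϱ ^ m) x) ⟩
  toℕ x                              ∎
  where
  open ≡-Reasoning
  d  = proj₁ (F.remQuot {ϱ} (ϱ ^ m) x)
  x′ = proj₂ (F.remQuot {ϱ} (ϱ ^ m) x)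

zip₃ : ∀ {A B C : Set} {n} → Vec A n → Vec B n → Vec C n → Vec (A × B × C) n
zip₃ as bs cs = V.zip as (V.zip bs cs)

zip₃-++ : ∀ {A B C : Set} {m n} (as : Vec A m) (bs : Vec B m) (cs : Vec C m)
          (as′ : Vec A n) (bs′ : Vec B n) (cs′ : Vec C n) →
          zip₃ (as ++ as′) (bs ++ bs′) (cs ++ cs′) ≡ zip₃ as bs cs ++ zip₃ as′ bs′ cs′
zip₃-++ as bs cs as′ bs′ cs′ =
  trans (cong (V.zip (as ++ as′)) (zipWith-++ _,_ bs bs′ cs cs′))
        (zipWith-++ _,_ as as′ (V.zip bs cs) (V.zip bs′ cs′))

map-proj-zip₃ : ∀ {A B C : Set} {n} (as : Vec A n) (bs : Vec B n) (cs : Vec C n) →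
                V.map proj₁ (zip₃ as bs cs) ≡ as ×
                V.map (proj₁ ∘ proj₂) (zip₃ as bs cs) ≡ bs ×
                V.map (proj₂ ∘ proj₂) (zip₃ as bs cs) ≡ cs
map-proj-zip₃ []       []       []       = refl , refl , refl
map-proj-zip₃ (a ∷ as) (b ∷ bs) (c ∷ cs) =
  let eqa , eqb , eqc = map-proj-zip₃ as bs cs in cong (a ∷_) eqa , cong (b ∷_) eqb , cong (c ∷_) eqc

decode-zip₃ : ∀ {r n} (as bs cs : Vec (Digit (suc r)) n) →
              decode (suc r) ((F.zero , F.zero , F.zero) ∷ toList (zip₃ as bs cs))
              ≡ (+ ⟦ as ⟧ , + ⟦ bs ⟧ , + ⟦ cs ⟧)
decode-zip₃ {r} as bs cs =
  let eqa , eqb , eqc = map-proj-zip₃ as bs cs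
  in cong₂ _,_ (track proj₁ eqa) (cong₂ _,_ (track (proj₁ ∘ proj₂) eqb) (track (proj₂ ∘ proj₂) eqc))
  where
  w = zip₃ as bs cs
  track : ∀ (f : Letter (suc r) → Digit (suc r)) {ds} → V.map f w ≡ ds →
          + valℕ (suc r) (L.map f (toList w)) ≡ + ⟦ ds ⟧
  track f eq = cong (+_ ∘ valℕ (suc r)) (trans (sym (toList-map f w)) (cong toList eq))

module _ {ϱ k : ℕ} (A : DFA ϱ k) where

  state : List⁺ (Letter ϱ) → Fin k
  state u = run A (initial A) (L⁺.toList u)

  state-⁺++ : ∀ u v → state (u ⁺++ v) ≡ run A (state u) v
  state-⁺++ u v = foldl-++ (δ A) (initial A) (L⁺.toList u) v

  Distinguishes : List⁺ (Letter ϱ) → List⁺ (Letter ϱ) → Set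
  Distinguishes u u′ = ∃ λ v → Accepts A (u ⁺++ v) × ¬ Accepts A (u′ ⁺++ v)

  same-state⇒¬Distinguishes : ∀ {u u′} → state u ≡ state u′ → ¬ Distinguishes u u′
  same-state⇒¬Distinguishes {u} {u′} eq (v , acc , ¬acc) =
    ¬acc (subst (λ q → accepting A q ≡ true) same-end acc)
    where
    same-end : state (u ⁺++ v) ≡ state (u′ ⁺++ v)
    same-end = trans (state-⁺++ u v) (trans (cong (λ q → run A q v) eq) (sym (state-⁺++ u′ v)))

  distinguishable⇒≤ : ∀ {n} (u : Fin n → List⁺ (Letter ϱ)) →
                      (∀ {x y} → x F.< y → Distinguishes (u x) (u y)) → n ≤ k
  distinguishable⇒≤ u dist = F.injective⇒≤ state∘u-injective
    where
    state∘u-injective : ∀ {x y} → state (u x) ≡ state (u y) → x ≡ y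
    state∘u-injective {x} {y} eq with F.<-cmp x y
    ... | tri< x<y _ _ = contradiction (dist x<y) (same-state⇒¬Distinguishes {u x} {u y} eq)
    ... | tri≈ _ x≡y _ = x≡y
    ... | tri> _ _ y<x = contradiction (dist y<x) (same-state⇒¬Distinguishes {u y} {u x} (sym eq))

MULT-+⇔ : ∀ {ϱ m a b c} → a < ϱ ^ m → b < ϱ ^ m → MULT ϱ m (+ a , + b , + c) ⇔ a * b ≡ c
MULT-+⇔ {a = a} {b} a<ϱᵐ b<ϱᵐ = mk⇔
  (λ (_ , _ , _ , _ , ab≡c) → +-injective (trans (pos-* a b) ab≡c))
  (λ ab≡c → +≤+ z≤n , +<+ a<ϱᵐ , +≤+ z≤n , +<+ b<ϱᵐ , trans (sym (pos-* a b)) (cong +_ ab≡c))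

high-part-of-product : ∀ {N} x → suc x < N →
                       ∃₂ λ (a b : Fin N) → ∃ λ (y : Fin N) → toℕ a * toℕ b ≡ x * N + toℕ y
high-part-of-product x 2+x≤N with m≤n⇒∃[o]m+o≡n 2+x≤N
... | t , refl = F.fromℕ< a<N , F.fromℕ< b<N , F.fromℕ< y<N , product
  where
  a<N : suc (x + t) < 2 + x + t
  a<N = n<1+n _
  b<N : suc x < 2 + x + t
  b<N = s≤s (s≤s (m≤m+n x t))
  y<N : suc t < 2 + x + t
  y<N = s≤s (s≤s (m≤n+m t x))
  identity : ∀ x t → (1 + (x + t)) * (1 + x) ≡ x * (2 + x + t) + (1 + t)
  identity = solve-∀
  product : toℕ (F.fromℕ< a<N) * toℕ (F.fromℕ< b<N) ≡ x * (2 + x + t) + toℕ (F.fromℕ< y<N)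
  product = begin
    toℕ (F.fromℕ< a<N) * toℕ (F.fromℕ< b<N) ≡⟨ cong₂ _*_ (toℕ-fromℕ< a<N) (toℕ-fromℕ< b<N) ⟩
    (1 + (x + t)) * (1 + x)                 ≡⟨ identity x t ⟩
    x * (2 + x + t) + (1 + t)               ≡⟨ cong (λ y → x * (2 + x + t) + y) (toℕ-fromℕ< y<N) ⟨
    x * (2 + x + t) + toℕ (F.fromℕ< y<N)    ∎
    where open ≡-Reasoning

module _ {r : ℕ} (m : ℕ) where
  private
    ϱ N : ℕ
    ϱ = suc r
    N = ϱ ^ m

    instance
      N≢0 : NonZero N
      N≢0 = m^n≢0 ϱ m

    zeros : Vec (Digit ϱ) m
    zeros = V.replicate m F.zero

    0ₗ : Letter ϱ
    0ₗ = F.zero , F.zero , F.zero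

  prefix : Fin N → List⁺ (Letter ϱ)
  prefix x = 0ₗ ∷ toList (zip₃ zeros zeros (digits ϱ m x))

  suffix : (a b y : Fin N) → List (Letter ϱ)
  suffix a b y = toList (zip₃ (digits ϱ m a) (digits ϱ m b) (digits ϱ m y))

  decode-prefix⁺++suffix : ∀ x a b y → decode ϱ (prefix x ⁺++ suffix a b y)
                                       ≡ (+ toℕ a , + toℕ b , + (toℕ x * N + toℕ y))
  decode-prefix⁺++suffix x a b y = begin
    decode ϱ (prefix x ⁺++ suffix a b y)
      ≡⟨ cong (λ w → decode ϱ (0ₗ ∷ w)) (toList-++ xs ys) ⟨
    decode ϱ (0ₗ ∷ toList (xs ++ ys))
      ≡⟨ cong (λ w → decode ϱ (0ₗ ∷ toList w)) (zip₃-++ zeros zeros dx da db dy) ⟨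
    decode ϱ (0ₗ ∷ toList (zip₃ (zeros ++ da) (zeros ++ db) (dx ++ dy)))
      ≡⟨ decode-zip₃ (zeros ++ da) (zeros ++ db) (dx ++ dy) ⟩
    (+ ⟦ zeros ++ da ⟧ , + ⟦ zeros ++ db ⟧ , + ⟦ dx ++ dy ⟧)
      ≡⟨ cong₂ _,_ (cong +_ (padded a)) (cong₂ _,_ (cong +_ (padded b)) (cong +_ concatenated)) ⟩
    (+ toℕ a , + toℕ b , + (toℕ x * N + toℕ y))
      ∎
    where
    open ≡-Reasoning
    da = digits ϱ m a
    db = digits ϱ m b
    dx = digits ϱ m x
    dy = digits ϱ m y
    xs = zip₃ zeros zeros dx
    ys = zip₃ da db dy
    padded : ∀ z → ⟦ zeros ++ digits ϱ m z ⟧ ≡ toℕ z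
    padded z = trans (⟦replicate0++⟧ {m = m} (digits ϱ m z)) (⟦digits⟧ ϱ m z)
    concatenated : ⟦ dx ++ dy ⟧ ≡ toℕ x * N + toℕ y
    concatenated = trans (⟦++⟧ dx dy) (cong₂ (λ p q → p * N + q) (⟦digits⟧ ϱ m x) (⟦digits⟧ ϱ m y))

  module _ {k} (A : DFA ϱ k) (rep : Represents A (MULT ϱ m)) where

    accepts⇔ : ∀ x a b y → Accepts A (prefix x ⁺++ suffix a b y) ⇔ toℕ a * toℕ b ≡ toℕ x * N + toℕ y
    accepts⇔ x a b y = ⇔.trans
      (subst (λ t → Accepts A w ⇔ MULT ϱ m t) (decode-prefix⁺++suffix x a b y) (rep w))
      (MULT-+⇔ {ϱ} {m} (toℕ<n a) (toℕ<n b))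
      where w = prefix x ⁺++ suffix a b y

    prefixes-distinguishable : ∀ {x x′} → x F.< x′ → Distinguishes A (prefix x) (prefix x′)
    prefixes-distinguishable {x} {x′} x<x′ =
      let a , b , y , ab≡xN+y = high-part-of-product (toℕ x) (<-≤-trans (s≤s x<x′) (toℕ<n x′))
      in suffix a b y , Equivalence.from (accepts⇔ x a b y) ab≡xN+y ,
         λ acc → <-irrefl (high-parts-equal ab≡xN+y (Equivalence.to (accepts⇔ x′ a b y) acc)) x<x′
      where
      high-parts-equal : ∀ {c y} → c ≡ toℕ x * N + y → c ≡ toℕ x′ * N + y → toℕ x ≡ toℕ x′
      high-parts-equal {y = y} refl eq = *-cancelʳ-≡ (toℕ x) (toℕ x′) N (+-cancelʳ-≡ y _ _ eq)

lemma5p2 : (ϱ : ℕ) → 2 ≤ ϱ → (m : ℕ) → (k : ℕ) → (A : DFA ϱ k) →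
           Represents A (MULT ϱ m) → ϱ ^ m ≤ k
lemma5p2 (suc r) _ m k A rep = distinguishable⇒≤ A (prefix m) (prefixes-distinguishable m A rep)
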